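{- Let $k\ge1$ and $h\ge 3$ be integers. Then $\pi'(T_{k,h})\le \left\lceil \frac{h+1}{2}k\right\rceil$.
   Context: $T_{k,h}$ is the rooted tree in which every non-leaf vertex has exactly $k$ children and every leaf is at distance $h$ from the root. A repetition is a finite sequence $x_1,\dots,x_{2r}$ ($r\ge1$) with $x_j=x_{j+r}$ for $1\le j\le r$. An edge-coloring of a graph is nonrepetitive if the sequence of colors along no (simple) path with at least one edge is a repetition. $\pi'(G)$ denotes the minimum number of colors in a nonrepetitive edge-coloring of $G$. -}

module Defs where

open import Data.Nat using (ℕ; zero; suc; _+_; _*_; _≤_; _≥_)
open import Data.Fin using (Fin)
open import Data.List using (List; []; _∷_; length; _++_)
open import Data.List.Relation.Unary.Unique.Propositional using (Unique)
open import Data.Product using (Σ; ∃; ∃-syntax; _×_; _,_; proj₁)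
open import Data.Sum using (_⊎_)
open import Relation.Nullary using (¬_)
open import Relation.Binary.PropositionalEquality using (_≡_)

record Graph : Set₁ where
  field
    V   : Set
    Adj : V → V → Set

open Graph public

data Walk (G : Graph) : List (V G) → Set where
  single : (v : V G) → Walk G (v ∷ [])
  step   : (u v : V G) (vs : List (V G)) →
           Adj G u v → Walk G (v ∷ vs) → Walk G (u ∷ v ∷ vs)

IsPath : (G : Graph) → List (V G) → Set
IsPath G vs = Walk G vs × Unique vs × (2 ≤ length vs)

-- Edge-colorings with colors Fin n, given as a function on ordered pairs of
-- vertices that is symmetric on edges (only values on edges matter).
record EdgeColoring (G : Graph) (n : ℕ) : Set where
  field
    col  : V G → V G → Fin n
    symm : (u v : V G) → Adj G u v → col u v ≡ col v u

open EdgeColoring public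

colorsAlong : {G : Graph} {n : ℕ} → EdgeColoring G n → List (V G) → List (Fin n)
colorsAlong c []           = []
colorsAlong c (u ∷ [])     = []
colorsAlong c (u ∷ v ∷ vs) = col c u v ∷ colorsAlong c (v ∷ vs)

IsRepetition : {A : Set} → List A → Set
IsRepetition {A} xs = Σ (List A) λ ys → (1 ≤ length ys) × (xs ≡ ys ++ ys)

Nonrepetitive : {G : Graph} {n : ℕ} → EdgeColoring G n → Set
Nonrepetitive {G} c = (vs : List (V G)) → IsPath G vs → ¬ IsRepetition (colorsAlong c vs)

πe≤ : Graph → ℕ → Set
πe≤ G N = Σ (EdgeColoring G N) Nonrepetitive

-- The complete k-ary tree of height h, T_{k,h}.  Vertices: words over Fin k of
-- length ≤ h (the root is [], the children of w are i ∷ w).  Edges: parent–child.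
TreeV : ℕ → ℕ → Set
TreeV k h = Σ (List (Fin k)) λ w → length w ≤ h

ChildOf : {k h : ℕ} → TreeV k h → TreeV k h → Set
ChildOf {k} v u = ∃[ i ] (proj₁ v ≡ (Data.List._∷_ {A = Fin k} i (proj₁ u)))

T : ℕ → ℕ → Graph
T k h = record { V = TreeV k h ; Adj = λ u v → ChildOf v u ⊎ ChildOf u v }

-- Colour the edge between a vertex and its child by the weight of the child modulo M,
-- where the vertex with address i₁ ∷ … ∷ iₗ has weight Σ (1 + iⱼ).  A path in the tree
-- climbs p edges and then descends, so the weights s j of the lower endpoints of its edges
-- first fall and then rise, by 1 to k per step; the two edges at the top lead to distinct
-- children of one vertex, so their weights differ, by less than k.  A repetition of period
-- r gives s j ≡ s (j + r) (mod M), and distinct congruent weights are at least M apart.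
-- If the top is at or next to an end of the path, two such gaps of M would have to be
-- bridged by at most h + 1 steps of size at most k, although (h + 1) k ≤ 2M.  Otherwise
-- two consecutive pairs j, j + r straddle the top, which forces M ≤ 2k; that happens only
-- for h = 3, leaving two short paths to rule out directly.

module Submission where

open import Data.Empty using (⊥; ⊥-elim)
open import Data.Fin using (Fin; toℕ)
open import Data.Fin.Properties using (toℕ<n; toℕ-injective; toℕ-fromℕ<)
open import Data.List using (List; []; _∷_; length; _++_)
open import Data.List.Properties using (∷-injectiveʳ; length-++)
open import Data.List.Relation.Unary.All as All using (All)
open import Data.List.Relation.Unary.Unique.Propositional as Unique using (Unique)
open import Data.Nat
open import Data.Nat.DivMod
open import Data.Nat.Properties
open import Data.Nat.Tactic.RingSolver using (solve)
open import Data.Product using (∃; _×_; _,_; proj₁; proj₂)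
open import Data.Sum using (_⊎_; inj₁; inj₂; [_,_]′)
open import Function using (_∘_)
open import Relation.Binary using (tri<; tri≈; tri>)
open import Relation.Binary.PropositionalEquality
open import Relation.Nullary using (¬_; yes; no)

open import Defs

Step : ℕ → ℕ → ℕ → Set
Step k a b = a < b × b ≤ a + k

record Steps (k t a b : ℕ) : Set where
  constructor steps
  field
    lower : a + t ≤ b
    upper : b ≤ a + t * k

Turn : ℕ → ℕ → ℕ → Set
Turn k a b = a ≢ b × a < b + k × b < a + k

module _ {d : ℕ} .{{_ : NonZero d}} where

  private
    %-≡∧/-<⇒+≤ : ∀ {m n} → m % d ≡ n % d → m / d < n / d → m + d ≤ n
    %-≡∧/-<⇒+≤ {m} {n} m%d≡n%d m/d<n/d = begin
      m + d                       ≡⟨ cong (_+ d) (m≡m%n+[m/n]*n m d) ⟩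
      m % d + m / d * d + d       ≡⟨ +-assoc (m % d) _ d ⟩
      m % d + (m / d * d + d)     ≡⟨ cong (m % d +_) (+-comm _ d) ⟩
      m % d + suc (m / d) * d     ≤⟨ +-mono-≤ (≤-reflexive m%d≡n%d) (*-monoˡ-≤ d m/d<n/d) ⟩
      n % d + n / d * d           ≡⟨ m≡m%n+[m/n]*n n d ⟨
      n                           ∎
      where open ≤-Reasoning

    %-≡∧/-≡⇒≡ : ∀ {m n} → m % d ≡ n % d → m / d ≡ n / d → m ≡ n
    %-≡∧/-≡⇒≡ {m} {n} m%d≡n%d m/d≡n/d = begin
      m                   ≡⟨ m≡m%n+[m/n]*n m d ⟩
      m % d + m / d * d   ≡⟨ cong₂ (λ a b → a + b * d) m%d≡n%d m/d≡n/d ⟩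
      n % d + n / d * d   ≡⟨ m≡m%n+[m/n]*n n d ⟨
      n                   ∎
      where open ≡-Reasoning

  %-≡∧<⇒+≤ : ∀ {m n} → m % d ≡ n % d → m < n → m + d ≤ n
  %-≡∧<⇒+≤ {m} {n} eq m<n with <-cmp (m / d) (n / d)
  ... | tri< lt _ _ = %-≡∧/-<⇒+≤ eq lt
  ... | tri≈ _ e _  = ⊥-elim (<-irrefl (%-≡∧/-≡⇒≡ eq e) m<n)
  ... | tri> _ _ gt = ⊥-elim (<⇒≱ m<n (≤-trans (m≤m+n n d) (%-≡∧/-<⇒+≤ (sym eq) gt)))

  %-≡∧near⇒≡ : ∀ {m n} → m < n + d → n < m + d → m % d ≡ n % d → m ≡ n
  %-≡∧near⇒≡ {m} {n} m<n+d n<m+d eq with <-cmp m n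
  ... | tri< lt _ _ = ⊥-elim (<⇒≱ n<m+d (%-≡∧<⇒+≤ eq lt))
  ... | tri≈ _ e _  = e
  ... | tri> _ _ gt = ⊥-elim (<⇒≱ m<n+d (%-≡∧<⇒+≤ (sym eq) gt))

  Turn⇒%-≢ : ∀ {k a b} → k ≤ d → Turn k a b → a % d ≢ b % d
  Turn⇒%-≢ k≤d (a≢b , a<b+k , b<a+k) =
    a≢b ∘ %-≡∧near⇒≡ (<-≤-trans a<b+k (+-monoʳ-≤ _ k≤d)) (<-≤-trans b<a+k (+-monoʳ-≤ _ k≤d))

  %-cong-+ : ∀ {m n o q} → m % d ≡ n % d → o % d ≡ q % d → (m + o) % d ≡ (n + q) % d
  %-cong-+ {m} {n} {o} {q} m≡n o≡q = begin
    (m + o) % d             ≡⟨ %-distribˡ-+ m o d ⟩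
    (m % d + o % d) % d     ≡⟨ cong₂ (λ a b → (a + b) % d) m≡n o≡q ⟩
    (n % d + q % d) % d     ≡⟨ %-distribˡ-+ n q d ⟨
    (n + q) % d             ∎
    where open ≡-Reasoning

module _ {k : ℕ} where

  Steps-refl : ∀ {a} → Steps k 0 a a
  Steps-refl {a} = steps (≤-reflexive (+-identityʳ a)) (m≤m+n a 0)

  Steps-snoc : ∀ {t a b c} → Steps k t a b → Step k b c → Steps k (suc t) a c
  Steps-snoc {t} {a} {b} {c} (steps a+t≤b b≤a+tk) (b<c , c≤b+k) = steps
    (≤-trans (≤-reflexive (+-suc a t)) (≤-trans (s≤s a+t≤b) b<c))
    (begin
      c                ≤⟨ c≤b+k ⟩
      b + k            ≤⟨ +-monoˡ-≤ k b≤a+tk ⟩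
      a + t * k + k    ≡⟨ +-assoc a (t * k) k ⟩
      a + (t * k + k)  ≡⟨ cong (a +_) (+-comm (t * k) k) ⟩
      a + suc t * k    ∎)
    where open ≤-Reasoning

  Steps-cons : ∀ {t a b c} → Step k a b → Steps k t b c → Steps k (suc t) a c
  Steps-cons {t} {a} {b} {c} (a<b , b≤a+k) (steps b+t≤c c≤b+tk) = steps
    (≤-trans (≤-reflexive (+-suc a t)) (≤-trans (+-monoˡ-≤ t a<b) b+t≤c))
    (begin
      c                ≤⟨ c≤b+tk ⟩
      b + t * k        ≤⟨ +-monoˡ-≤ (t * k) b≤a+k ⟩
      a + k + t * k    ≡⟨ +-assoc a k (t * k) ⟩
      a + suc t * k    ∎)
    where open ≤-Reasoning

  Steps⇒< : ∀ {t a b} → Steps k (suc t) a b → a < b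
  Steps⇒< {t} {a} (steps a+t+1≤b _) = <-≤-trans (m<m+n a z<s) a+t+1≤b

-- The weight profile of a path whose first p edges climb and whose other edges descend.
record Valley (k n p : ℕ) (s : ℕ → ℕ) : Set where
  field
    p≤n      : p ≤ n
    descends : ∀ j → suc j < p → Step k (s (suc j)) (s j)
    ascends  : ∀ j → p ≤ j → suc j < n → Step k (s j) (s (suc j))
    turns    : ∀ j → suc j ≡ p → p < n → Turn k (s j) (s (suc j))

module _ {k n p : ℕ} {s : ℕ → ℕ} (v : Valley k n p s) where
  open Valley v

  descent : ∀ i t → i + t < p → Steps k t (s (i + t)) (s i)
  descent i zero _ rewrite +-identityʳ i = Steps-refl
  descent i (suc t) i+t<p rewrite +-suc i t =
    Steps-cons (descends (i + t) i+t<p) (descent i t (<-trans (n<1+n _) i+t<p))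

  ascent : ∀ i t → p ≤ i → i + t < n → Steps k t (s i) (s (i + t))
  ascent i zero _ _ rewrite +-identityʳ i = Steps-refl
  ascent i (suc t) p≤i i+t<n rewrite +-suc i t =
    Steps-snoc (ascent i t p≤i (<-trans (n<1+n _) i+t<n)) (ascends (i + t) (≤-trans p≤i (m≤m+n i t)) i+t<n)

-- Around b ↘ a ↗ d ↘ c ↗ b the two drops of at least M are made up by rises of at most x
-- and y; e = 1 accounts for one strict rise.
cycle-bound : ∀ {b d} M a c x y e → a + M ≤ b → c + M ≤ d → d ≤ a + x → e + b ≤ c + y → e + (M + M) ≤ x + y
cycle-bound {b} {d} M a c x y e a+M≤b c+M≤d d≤a+x e+b≤c+y =
  +-cancelˡ-≤ (a + c) _ _ (begin
    a + c + (e + (M + M))   ≡⟨ solve (a ∷ c ∷ e ∷ M ∷ []) ⟩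
    (a + M) + (e + (c + M)) ≤⟨ +-mono-≤ a+M≤b (+-monoʳ-≤ e c+M≤d) ⟩
    b + (e + d)             ≡⟨ solve (b ∷ e ∷ d ∷ []) ⟩
    (e + b) + d             ≤⟨ +-mono-≤ e+b≤c+y d≤a+x ⟩
    (c + y) + (a + x)       ≡⟨ solve (a ∷ c ∷ x ∷ y ∷ []) ⟩
    a + c + (x + y)         ∎)
  where open ≤-Reasoning

m+m≤n+n⇒m≤n : ∀ {m n} → m + m ≤ n + n → m ≤ n
m+m≤n+n⇒m≤n m+m≤n+n = ≮⇒≥ λ n<m → <⇒≱ (+-mono-< n<m n<m) m+m≤n+n

-- (a + b′) − (b + a′) = (a − a′) + (b′ − b) is a multiple of M lying in [2, 2k].
crossing : ∀ {k M a a′ b b′} .{{_ : NonZero M}} → Step k a′ a → Step k b b′ →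
           (a + b′) % M ≡ (b + a′) % M → M ≤ k + k × (M ≡ k + k → a ≡ a′ + k)
crossing {k} {M} {a} {a′} {b} {b′} (a′<a , a≤a′+k) (b<b′ , b′≤b+k) eq =
  +-cancelˡ-≤ (b + a′) M (k + k) (≤-trans far close) ,
  λ M≡k+k → ≤-antisym a≤a′+k (≮⇒≥ λ a<a′+k →
    <-irrefl refl (begin-strict
      b + a′ + (k + k)    ≡⟨ cong (b + a′ +_) M≡k+k ⟨
      b + a′ + M          ≤⟨ far ⟩
      a + b′              <⟨ +-mono-<-≤ a<a′+k b′≤b+k ⟩
      a′ + k + (b + k)    ≡⟨ solve (a′ ∷ b ∷ k ∷ []) ⟩
      b + a′ + (k + k)    ∎))
  where
    open ≤-Reasoning
    distinct : b + a′ < a + b′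
    distinct = begin-strict
      b + a′  ≡⟨ +-comm b a′ ⟩
      a′ + b  <⟨ +-mono-< a′<a b<b′ ⟩
      a + b′  ∎
    far : b + a′ + M ≤ a + b′
    far = %-≡∧<⇒+≤ (sym eq) distinct
    close : a + b′ ≤ b + a′ + (k + k)
    close = begin
      a + b′            ≤⟨ +-mono-≤ a≤a′+k b′≤b+k ⟩
      a′ + k + (b + k)  ≡⟨ solve (a′ ∷ b ∷ k ∷ []) ⟩
      b + a′ + (k + k)  ∎

turn-2-or-3 : ∀ p r′ → 2 ≤ p → p ≤ 3 → suc p < suc r′ + suc r′ → suc r′ + suc r′ ≤ p + 3 →
              (p ≡ 2 × r′ ≡ 1) ⊎ (p ≡ 3 × r′ ≡ 2)
turn-2-or-3 p r′ 2≤p p≤3 lo hi = go p r′ 2≤p p≤3 lo hi (m+m≤n+n⇒m≤n (≤-trans hi (+-monoˡ-≤ 3 p≤3)))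
  where
    go : ∀ p r′ → 2 ≤ p → p ≤ 3 → suc p < suc r′ + suc r′ → suc r′ + suc r′ ≤ p + 3 → suc r′ ≤ 3 →
         (p ≡ 2 × r′ ≡ 1) ⊎ (p ≡ 3 × r′ ≡ 2)
    go 2 1 _ _ _ _ _ = inj₁ (refl , refl)
    go 3 2 _ _ _ _ _ = inj₂ (refl , refl)
    go 2 0 _ _ (s≤s (s≤s ())) _ _
    go 3 0 _ _ (s≤s (s≤s ())) _ _
    go 3 1 _ _ (s≤s (s≤s (s≤s (s≤s ())))) _ _
    go 2 2 _ _ _ (s≤s (s≤s (s≤s (s≤s (s≤s ()))))) _
    go _ (suc (suc (suc _))) _ _ _ _ (s≤s (s≤s (s≤s ())))
    go 0 _ () _ _ _ _
    go 1 _ (s≤s ()) _ _ _ _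
    go (suc (suc (suc (suc _)))) _ _ (s≤s (s≤s (s≤s ()))) _ _ _

module _ {k h M : ℕ} .{{_ : NonZero M}} (1≤k : 1 ≤ k) (3≤h : 3 ≤ h) (wide : (h + 1) * k ≤ M + M) where

  private
    wide′ : suc h * k ≤ M + M
    wide′ = subst (λ x → x * k ≤ M + M) (+-comm h 1) wide

  long-span : ∀ {m} → m ≤ suc h → m * k ≤ M + M
  long-span m≤1+h = ≤-trans (*-monoˡ-≤ k m≤1+h) wide′

  short-span : ∀ {m} → m ≤ h → m * k < M + M
  short-span {m} m≤h = <-≤-trans (m<n+m (m * k) 1≤k) (long-span (s≤s m≤h))

  k+k≤M : k + k ≤ M
  k+k≤M = m+m≤n+n⇒m≤n (begin
    k + k + (k + k)  ≡⟨ solve (k ∷ []) ⟩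
    4 * k            ≤⟨ long-span (s≤s 3≤h) ⟩
    M + M            ∎)
    where open ≤-Reasoning

  k≤M : k ≤ M
  k≤M = ≤-trans (m≤m+n k k) k+k≤M

  M≡k+k⇒h≡3 : M ≡ k + k → h ≡ 3
  M≡k+k⇒h≡3 M≡k+k with m≤n⇒m<n∨m≡n 3≤h
  ... | inj₂ 3≡h = sym 3≡h
  ... | inj₁ 4≤h = ⊥-elim (<-irrefl refl (begin-strict
    4 * k        <⟨ m<n+m (4 * k) 1≤k ⟩
    5 * k        ≤⟨ long-span (s≤s 4≤h) ⟩
    M + M        ≡⟨ cong₂ _+_ M≡k+k M≡k+k ⟩
    k + k + (k + k) ≡⟨ solve (k ∷ []) ⟩
    4 * k        ∎))
    where open ≤-Reasoning

  module ValleyCases {s : ℕ → ℕ} {p : ℕ} (r′ : ℕ) (v : Valley k (suc r′ + suc r′) p s)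
    (p≤h : p ≤ h) (n≤p+h : suc r′ + suc r′ ≤ p + h)
    (rep : ∀ j → j < suc r′ → s j % M ≡ s (j + suc r′) % M) where

    open Valley v

    r n : ℕ
    r = suc r′
    n = r + r

    r<n : r < n
    r<n = m<m+n r (s≤s z≤n)

    r′+r<n : r′ + r < n
    r′+r<n = +-monoˡ-< r (n<1+n r′)

    M-above : ∀ {j} → j < r → s j < s (j + r) → s j + M ≤ s (j + r)
    M-above j<r = %-≡∧<⇒+≤ (rep _ j<r)

    M-below : ∀ {j} → j < r → s (j + r) < s j → s (j + r) + M ≤ s j
    M-below j<r = %-≡∧<⇒+≤ (sym (rep _ j<r))

    descending : p ≡ n → ⊥
    descending refl =
      <⇒≱ (short-span p≤h) (cycle-bound M (s r) (s (r′ + r)) k ((r′ + r) * k) 0 drop₁ drop₂ rise₁ rise₂)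
      where
        drop₁ : s r + M ≤ s 0
        drop₁ = M-below (s≤s z≤n) (Steps⇒< (descent v 0 r r<n))
        drop₂ : s (r′ + r) + M ≤ s r′
        drop₂ = M-below (n<1+n r′) (Steps⇒< (descent v r′ r r′+r<n))
        rise₁ : s r′ ≤ s r + k
        rise₁ = proj₂ (descends r′ r<n)
        rise₂ : s 0 ≤ s (r′ + r) + (r′ + r) * k
        rise₂ = Steps.upper (descent v 0 (r′ + r) r′+r<n)

    ascending : p ≡ 0 → ⊥
    ascending refl =
      <⇒≱ (short-span n≤p+h) (cycle-bound M (s r′) (s 0) k ((r′ + r) * k) 0 drop₁ drop₂ rise₁ rise₂)
      where
        drop₁ : s r′ + M ≤ s (r′ + r)
        drop₁ = M-above (n<1+n r′) (Steps⇒< (ascent v r′ r z≤n r′+r<n))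
        drop₂ : s 0 + M ≤ s r
        drop₂ = M-above (s≤s z≤n) (Steps⇒< (ascent v 0 r z≤n r<n))
        rise₁ : s r ≤ s r′ + k
        rise₁ = proj₂ (ascends r′ z≤n r<n)
        rise₂ : s (r′ + r) ≤ s 0 + (r′ + r) * k
        rise₂ = Steps.upper (ascent v 0 (r′ + r) z≤n r′+r<n)

    single-turn : r′ ≡ 0 → suc p ≡ n → ⊥
    single-turn refl refl = Turn⇒%-≢ k≤M (turns 0 refl ≤-refl) (rep 0 (s≤s z≤n))

    late-turn : ∀ {t} → suc t ≡ r′ → suc p ≡ n → ⊥
    late-turn {t} refl refl =
      ≤⇒≯ (long-span (s≤s p≤h)) (cycle-bound M (s r) (s (r′ + r)) k ((r′ + r) * k) 1 drop₁ drop₂ rise₁ rise₂)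
      where
        turnₜ : Turn k (s (t + r)) (s (r′ + r))
        turnₜ = turns (t + r) refl ≤-refl
        r<p : r < p
        r<p = s≤s (m≤n+m r t)
        drop₁ : s r + M ≤ s 0
        drop₁ = M-below (s≤s z≤n) (Steps⇒< (descent v 0 r r<p))
        climb : s (r′ + r) < s r′
        climb = ≰⇒> λ s[r′]≤s[r′+r] → <-irrefl refl (begin-strict
          s (t + r) + M          ≤⟨ M-below (m≤n⇒m≤1+n (n<1+n t)) (Steps⇒< (descent v t r ≤-refl)) ⟩
          s t                    ≤⟨ proj₂ (descends t (s≤s (m<m+n t (s≤s z≤n)))) ⟩
          s r′ + k               ≤⟨ +-monoˡ-≤ k s[r′]≤s[r′+r] ⟩
          s (r′ + r) + k         <⟨ +-monoˡ-< k (proj₂ (proj₂ turnₜ)) ⟩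
          s (t + r) + k + k      ≡⟨ +-assoc (s (t + r)) k k ⟩
          s (t + r) + (k + k)    ≤⟨ +-monoʳ-≤ (s (t + r)) k+k≤M ⟩
          s (t + r) + M          ∎)
          where open ≤-Reasoning
        drop₂ : s (r′ + r) + M ≤ s r′
        drop₂ = M-below (n<1+n r′) climb
        rise₁ : s r′ ≤ s r + k
        rise₁ = proj₂ (descends r′ r<p)
        rise₂ : suc (s 0) ≤ s (r′ + r) + (r′ + r) * k
        rise₂ = begin
          suc (s 0)                        ≤⟨ s≤s (Steps.upper (descent v 0 (t + r) ≤-refl)) ⟩
          suc (s (t + r)) + (t + r) * k    ≤⟨ +-monoˡ-≤ ((t + r) * k) (proj₁ (proj₂ turnₜ)) ⟩
          s (r′ + r) + k + (t + r) * k     ≡⟨ +-assoc (s (r′ + r)) k ((t + r) * k) ⟩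
          s (r′ + r) + (r′ + r) * k        ∎
          where open ≤-Reasoning

    early-turn : 1 ≤ r′ → p ≡ 1 → ⊥
    early-turn 1≤r′ refl =
      ≤⇒≯ (long-span n≤2+r′+r′) (cycle-bound M (s r′) (s 0) k (suc (r′ + r′) * k) 1 drop₁ drop₂ rise₁ rise₂)
      where
        n≤2+r′+r′ : suc (suc (r′ + r′)) ≤ suc h
        n≤2+r′+r′ = subst (_≤ suc h) (cong suc (+-suc r′ r′)) n≤p+h
        1+r<n : suc r < n
        1+r<n = s≤s (+-monoˡ-≤ r 1≤r′)
        turn₀ : Turn k (s 0) (s 1)
        turn₀ = turns 0 refl (s≤s (≤-trans 1≤r′ (m≤m+n r′ r)))
        drop₁ : s r′ + M ≤ s (r′ + r)
        drop₁ = M-above (n<1+n r′) (Steps⇒< (ascent v r′ r 1≤r′ r′+r<n))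
        climb : s 0 < s r
        climb = ≰⇒> λ s[r]≤s[0] → <-irrefl refl (begin-strict
          s 1 + M            ≤⟨ M-above (s≤s 1≤r′) (Steps⇒< (ascent v 1 r ≤-refl 1+r<n)) ⟩
          s (suc r)          ≤⟨ proj₂ (ascends r (s≤s z≤n) 1+r<n) ⟩
          s r + k            ≤⟨ +-monoˡ-≤ k s[r]≤s[0] ⟩
          s 0 + k            <⟨ +-monoˡ-< k (proj₁ (proj₂ turn₀)) ⟩
          s 1 + k + k        ≡⟨ +-assoc (s 1) k k ⟩
          s 1 + (k + k)      ≤⟨ +-monoʳ-≤ (s 1) k+k≤M ⟩
          s 1 + M            ∎)
          where open ≤-Reasoning
        drop₂ : s 0 + M ≤ s r
        drop₂ = M-above (s≤s z≤n) climb
        rise₁ : s r ≤ s r′ + k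
        rise₁ = proj₂ (ascends r′ 1≤r′ r<n)
        rise₂ : suc (s (r′ + r)) ≤ s 0 + suc (r′ + r′) * k
        rise₂ = begin
          suc (s (r′ + r))              ≡⟨ cong (suc ∘ s) (+-suc r′ r′) ⟩
          suc (s (1 + (r′ + r′)))       ≤⟨ s≤s (Steps.upper (ascent v 1 (r′ + r′) ≤-refl
                                                  (s≤s (≤-reflexive (sym (+-suc r′ r′)))))) ⟩
          suc (s 1) + (r′ + r′) * k     ≤⟨ +-monoˡ-≤ ((r′ + r′) * k) (proj₂ (proj₂ turn₀)) ⟩
          s 0 + k + (r′ + r′) * k       ≡⟨ +-assoc (s 0) k ((r′ + r′) * k) ⟩
          s 0 + suc (r′ + r′) * k       ∎
          where open ≤-Reasoning

    crossing-at : ∀ j → suc j < p → p ≤ j + r → suc j < r → M ≤ k + k × (M ≡ k + k → s j ≡ s (suc j) + k)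
    crossing-at j 1+j<p p≤j+r 1+j<r =
      crossing (descends j 1+j<p) (ascends (j + r) p≤j+r (+-monoˡ-< r 1+j<r))
               (%-cong-+ (rep j (<-trans (n<1+n j) 1+j<r)) (sym (rep (suc j) 1+j<r)))

    crossing-before : p ≤ r → ∀ j → suc j < p → M ≤ k + k × (M ≡ k + k → s j ≡ s (suc j) + k)
    crossing-before p≤r j 1+j<p = crossing-at j 1+j<p (≤-trans p≤r (m≤n+m r j)) (<-≤-trans 1+j<p p≤r)

    M≤k+k : 1 ≤ r′ → 2 ≤ p → suc p < n → M ≤ k + k
    M≤k+k 1≤r′ 2≤p 1+p<n with p ≤? r
    ... | yes p≤r = proj₁ (crossing-before p≤r 0 2≤p)
    ... | no p≰r with m≤n⇒∃[o]m+o≡n (<⇒≤ (≰⇒> p≰r))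
    ...   | e , r+e≡p = proj₁ (crossing-at e 1+e<p p≤e+r 1+e<r)
      where
        1+e<p : suc e < p
        1+e<p = subst (suc (suc e) ≤_) r+e≡p (+-monoˡ-≤ e (s≤s 1≤r′))
        p≤e+r : p ≤ e + r
        p≤e+r = ≤-reflexive (trans (sym r+e≡p) (+-comm r e))
        1+e<r : suc e < r
        1+e<r = +-cancelˡ-≤ r _ _ (begin
          r + suc (suc e)     ≡⟨ +-suc r (suc e) ⟩
          suc (r + suc e)     ≡⟨ cong suc (+-suc r e) ⟩
          suc (suc (r + e))   ≡⟨ cong (suc ∘ suc) r+e≡p ⟩
          suc (suc p)         ≤⟨ 1+p<n ⟩
          n                   ∎)
          where open ≤-Reasoning

    turn-at-2 : p ≡ 2 → r′ ≡ 1 → M ≡ k + k → ⊥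
    turn-at-2 refl refl M≡k+k = <-irrefl (trans (sym s₀≡s₂) s₀≡s₁+k) s₂<s₁+k
      where
        turn₁ : Turn k (s 1) (s 2)
        turn₁ = turns 1 refl (s≤s (s≤s (s≤s z≤n)))
        s₂<s₁+k : s 2 < s 1 + k
        s₂<s₁+k = proj₂ (proj₂ turn₁)
        s₀≡s₁+k : s 0 ≡ s 1 + k
        s₀≡s₁+k = proj₂ (crossing-before ≤-refl 0 ≤-refl) M≡k+k
        s₀<s₂+M : s 0 < s 2 + M
        s₀<s₂+M = begin-strict
          s 0            ≡⟨ s₀≡s₁+k ⟩
          s 1 + k        <⟨ +-monoˡ-< k (proj₁ (proj₂ turn₁)) ⟩
          s 2 + k + k    ≡⟨ +-assoc (s 2) k k ⟩
          s 2 + (k + k)  ≡⟨ cong (s 2 +_) M≡k+k ⟨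
          s 2 + M        ∎
          where open ≤-Reasoning
        s₂<s₀+M : s 2 < s 0 + M
        s₂<s₀+M = <-≤-trans (subst (s 2 <_) (sym s₀≡s₁+k) s₂<s₁+k) (m≤m+n (s 0) M)
        s₀≡s₂ : s 0 ≡ s 2
        s₀≡s₂ = %-≡∧near⇒≡ s₀<s₂+M s₂<s₀+M (rep 0 (s≤s z≤n))

    turn-at-3 : p ≡ 3 → r′ ≡ 2 → M ≡ k + k → ⊥
    turn-at-3 refl refl M≡k+k = Turn⇒%-≢ k≤M (turns 2 refl (s≤s (s≤s (s≤s (s≤s z≤n))))) s₂≡s₃
      where
        s₀≡s₂+M : s 0 ≡ s 2 + M
        s₀≡s₂+M = begin
          s 0            ≡⟨ proj₂ (crossing-before ≤-refl 0 (s≤s (s≤s z≤n))) M≡k+k ⟩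
          s 1 + k        ≡⟨ cong (_+ k) (proj₂ (crossing-before ≤-refl 1 ≤-refl) M≡k+k) ⟩
          s 2 + k + k    ≡⟨ +-assoc (s 2) k k ⟩
          s 2 + (k + k)  ≡⟨ cong (s 2 +_) M≡k+k ⟨
          s 2 + M        ∎
          where open ≡-Reasoning
        s₂≡s₃ : s 2 % M ≡ s 3 % M
        s₂≡s₃ = begin
          s 2 % M        ≡⟨ [m+n]%n≡m%n (s 2) M ⟨
          (s 2 + M) % M  ≡⟨ cong (_% M) s₀≡s₂+M ⟨
          s 0 % M        ≡⟨ rep 0 (s≤s z≤n) ⟩
          s 3 % M        ∎
          where open ≡-Reasoning

    middle-turn : 1 ≤ r′ → 2 ≤ p → suc p < n → ⊥
    middle-turn 1≤r′ 2≤p 1+p<n =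
      [ (λ (p≡2 , r′≡1) → turn-at-2 p≡2 r′≡1 M≡k+k) , (λ (p≡3 , r′≡2) → turn-at-3 p≡3 r′≡2 M≡k+k) ]′
        (turn-2-or-3 p r′ 2≤p (subst (p ≤_) h≡3 p≤h) 1+p<n (subst (λ x → n ≤ p + x) h≡3 n≤p+h))
      where
        M≡k+k : M ≡ k + k
        M≡k+k = ≤-antisym (M≤k+k 1≤r′ 2≤p 1+p<n) k+k≤M
        h≡3 : h ≡ 3
        h≡3 = M≡k+k⇒h≡3 M≡k+k

    1+p<n : p ≢ n → suc p ≢ n → suc p < n
    1+p<n p≢n 1+p≢n = ≤∧≢⇒< (≤∧≢⇒< p≤n p≢n) 1+p≢n

    impossible : ⊥
    impossible with p ≟ n | p ≟ 0
    ... | yes p≡n | _       = descending p≡n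
    ... | no _    | yes p≡0 = ascending p≡0
    ... | no p≢n  | no p≢0 with suc p ≟ n | r′ ≟ 0 | p ≟ 1
    ...   | yes 1+p≡n | yes r′≡0 | _       = single-turn r′≡0 1+p≡n
    ...   | yes 1+p≡n | no r′≢0  | _       = late-turn (proj₂ (m≤n⇒∃[o]m+o≡n (n≢0⇒n>0 r′≢0))) 1+p≡n
    ...   | no 1+p≢n  | yes r′≡0 | _       =
            p≢0 (n≤0⇒n≡0 (≤-pred (≤-pred (subst (λ x → suc p < suc x + suc x) r′≡0 (1+p<n p≢n 1+p≢n)))))
    ...   | no _      | no r′≢0  | yes p≡1 = early-turn (n≢0⇒n>0 r′≢0) p≡1
    ...   | no 1+p≢n  | no r′≢0  | no p≢1  =
            middle-turn (n≢0⇒n>0 r′≢0) (≤∧≢⇒< (n≢0⇒n>0 p≢0) (p≢1 ∘ sym)) (1+p<n p≢n 1+p≢n)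

  valley-not-repetition : ∀ {s p} r′ → Valley k (suc r′ + suc r′) p s → p ≤ h → suc r′ + suc r′ ≤ p + h →
                          ¬ (∀ j → j < suc r′ → s j % M ≡ s (j + suc r′) % M)
  valley-not-repetition r′ v p≤h n≤p+h rep = ValleyCases.impossible r′ v p≤h n≤p+h rep

module _ {A : Set} (d : A) where

  nth : List A → ℕ → A
  nth []       _       = d
  nth (x ∷ xs) zero    = x
  nth (x ∷ xs) (suc j) = nth xs j

  nth-++ˡ : ∀ (ys zs : List A) {j} → j < length ys → nth (ys ++ zs) j ≡ nth ys j
  nth-++ˡ (y ∷ ys) zs {zero}  _         = refl
  nth-++ˡ (y ∷ ys) zs {suc j} (s≤s j<n) = nth-++ˡ ys zs j<n

  nth-++ʳ : ∀ (ys zs : List A) j → nth (ys ++ zs) (length ys + j) ≡ nth zs j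
  nth-++ʳ []       zs j = refl
  nth-++ʳ (y ∷ ys) zs j = nth-++ʳ ys zs j

  nth-++-self : ∀ (ys : List A) {j} → j < length ys → nth (ys ++ ys) j ≡ nth (ys ++ ys) (j + length ys)
  nth-++-self ys {j} j<n = begin
    nth (ys ++ ys) j                  ≡⟨ nth-++ˡ ys ys j<n ⟩
    nth ys j                          ≡⟨ nth-++ʳ ys ys j ⟨
    nth (ys ++ ys) (length ys + j)    ≡⟨ cong (nth (ys ++ ys)) (+-comm (length ys) j) ⟩
    nth (ys ++ ys) (j + length ys)    ∎
    where open ≡-Reasoning

  All-nth : ∀ {P : A → Set} {xs} → All P xs → ∀ {j} → j < length xs → P (nth xs j)
  All-nth (px All.∷ _)   {zero}  _         = px
  All-nth (_  All.∷ pxs) {suc j} (s≤s j<n) = All-nth pxs j<n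

  Unique-nth : ∀ {xs} → Unique xs → ∀ {i j} → i < j → j < length xs → nth xs i ≢ nth xs j
  Unique-nth (x∉xs Unique.∷ _) {zero}  {suc j} _         (s≤s j<n) = All-nth x∉xs j<n
  Unique-nth (_ Unique.∷ uniq) {suc i} {suc j} (s≤s i<j) (s≤s j<n) = Unique-nth uniq i<j j<n

module _ {G : Graph} (d : V G) where

  Walk-nth : ∀ {vs} → Walk G vs → ∀ {j} → suc j < length vs → Adj G (nth d vs j) (nth d vs (suc j))
  Walk-nth (single v)          (s≤s ())
  Walk-nth (step u v vs uv _)  {zero}  _         = uv
  Walk-nth (step u v vs _ walk) {suc j} (s≤s j<n) = Walk-nth walk j<n

  module _ {n} (c : EdgeColoring G n) where

    colorsAlong-nth : ∀ {d′} vs {j} → suc j < length vs →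
                      nth d′ (colorsAlong c vs) j ≡ col c (nth d vs j) (nth d vs (suc j))
    colorsAlong-nth (u ∷ [])     (s≤s ())
    colorsAlong-nth (u ∷ v ∷ vs) {zero}  _         = refl
    colorsAlong-nth (u ∷ v ∷ vs) {suc j} (s≤s j<n) = colorsAlong-nth (v ∷ vs) j<n

length-colorsAlong : ∀ {G n} (c : EdgeColoring G n) v vs →
                     suc (length (colorsAlong c (v ∷ vs))) ≡ length (v ∷ vs)
length-colorsAlong c v []       = refl
length-colorsAlong c v (w ∷ vs) = cong suc (length-colorsAlong c w vs)

Step-+ : ∀ {k} a (i : Fin k) → Step k a (suc (toℕ i) + a)
Step-+ {k} a i = s≤s (m≤n+m a (toℕ i)) , (begin
  suc (toℕ i) + a  ≤⟨ +-monoˡ-≤ a (toℕ<n i) ⟩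
  k + a            ≡⟨ +-comm k a ⟩
  a + k            ∎)
  where open ≤-Reasoning

Turn-+ : ∀ {k} a {i j : Fin k} → i ≢ j → Turn k (suc (toℕ i) + a) (suc (toℕ j) + a)
Turn-+ {k} a {i} {j} i≢j =
  i≢j ∘ toℕ-injective ∘ suc-injective ∘ +-cancelʳ-≡ a _ _ , close i j , close j i
  where
    close : ∀ i j → suc (toℕ i) + a < suc (toℕ j) + a + k
    close i j = begin-strict
      suc (toℕ i) + a       ≤⟨ +-monoˡ-≤ a (toℕ<n i) ⟩
      k + a                 ≡⟨ +-comm k a ⟩
      a + k                 <⟨ +-monoˡ-< k (m<n+m a z<s) ⟩
      suc (toℕ j) + a + k   ∎
      where open ≤-Reasoning

module _ {k h : ℕ} where

  weight : List (Fin k) → ℕ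
  weight []      = 0
  weight (i ∷ w) = suc (toℕ i) + weight w

  vertexWeight : TreeV k h → ℕ
  vertexWeight = weight ∘ proj₁

  depth : TreeV k h → ℕ
  depth = length ∘ proj₁

  TreeV-≡ : {u v : TreeV k h} → proj₁ u ≡ proj₁ v → u ≡ v
  TreeV-≡ {w , p} {.w , q} refl = cong (w ,_) (≤-irrelevant p q)

  edgeWeight : TreeV k h → TreeV k h → ℕ
  edgeWeight u v = vertexWeight u ⊔ vertexWeight v

  weightColoring : (M : ℕ) .{{_ : NonZero M}} → EdgeColoring (T k h) M
  weightColoring M = record
    { col  = λ u v → edgeWeight u v mod M
    ; symm = λ u v _ → cong (_mod M) (⊔-comm (vertexWeight u) (vertexWeight v))
    }

  ChildOf⇒weight≤ : (w u : TreeV k h) → ChildOf w u → vertexWeight u ≤ vertexWeight w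
  ChildOf⇒weight≤ w u (i , w≡i∷u) = subst (vertexWeight u ≤_) (sym (cong weight w≡i∷u)) (m≤n+m _ (suc (toℕ i)))

  edgeWeight-childˡ : (w u : TreeV k h) → ChildOf w u → edgeWeight w u ≡ vertexWeight w
  edgeWeight-childˡ w u = m≥n⇒m⊔n≡m ∘ ChildOf⇒weight≤ w u

  edgeWeight-childʳ : (u w : TreeV k h) → ChildOf w u → edgeWeight u w ≡ vertexWeight w
  edgeWeight-childʳ u w = m≤n⇒m⊔n≡n ∘ ChildOf⇒weight≤ w u

  module PathProfile {vs : List (TreeV k h)} (walk : Walk (T k h) vs) (uniq : Unique vs)
                     (n : ℕ) (len : length vs ≡ suc n) where

    v : ℕ → TreeV k h
    v = nth ([] , z≤n) vs

    s : ℕ → ℕ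
    s j = edgeWeight (v j) (v (suc j))

    Climbs Falls : ℕ → Set
    Climbs j = ChildOf (v j) (v (suc j))
    Falls j  = ChildOf (v (suc j)) (v j)

    s-climb : ∀ j → Climbs j → s j ≡ vertexWeight (v j)
    s-climb j = edgeWeight-childˡ (v j) (v (suc j))

    s-fall : ∀ j → Falls j → s j ≡ vertexWeight (v (suc j))
    s-fall j = edgeWeight-childʳ (v j) (v (suc j))

    edge : ∀ {j} → j < n → Falls j ⊎ Climbs j
    edge j<n = Walk-nth _ walk (subst (_ <_) (sym len) (s≤s j<n))

    distinct : ∀ {i j} → i < j → j ≤ n → v i ≢ v j
    distinct i<j j≤n = Unique-nth _ uniq i<j (subst (_ <_) (sym len) (s≤s j≤n))

    falls-persist : ∀ {j} → Falls j → suc j < n → Falls (suc j)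
    falls-persist {j} (_ , vⱼ₊₁≡i∷vⱼ) 1+j<n with edge 1+j<n
    ... | inj₁ falls = falls
    ... | inj₂ (_ , vⱼ₊₁≡i′∷vⱼ₊₂) =
          ⊥-elim (distinct (n≤1+n (suc j)) 1+j<n (TreeV-≡ (∷-injectiveʳ (trans (sym vⱼ₊₁≡i∷vⱼ) vⱼ₊₁≡i′∷vⱼ₊₂))))

    turn-search : ∀ m → m ≤ n → ∃ λ p → p ≤ m × (∀ {j} → j < p → Climbs j) × (p < m → Falls p)
    turn-search zero    _     = 0 , z≤n , (λ ()) , λ ()
    turn-search (suc m) 1+m≤n with turn-search m (<⇒≤ 1+m≤n)
    ... | p , p≤m , climbs , falls with m≤n⇒m<n∨m≡n p≤m
    ...   | inj₁ p<m  = p , m≤n⇒m≤1+n p≤m , climbs , λ _ → falls p<m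
    ...   | inj₂ refl with edge 1+m≤n
    ...     | inj₁ fallsₚ  = p , n≤1+n p , climbs , λ _ → fallsₚ
    ...     | inj₂ climbsₚ = suc p , ≤-refl , climbs′ , λ p<p → ⊥-elim (<-irrefl refl p<p)
      where
        climbs′ : ∀ {j} → j < suc p → Climbs j
        climbs′ j<1+p with m<1+n⇒m<n∨m≡n j<1+p
        ... | inj₁ j<p  = climbs j<p
        ... | inj₂ refl = climbsₚ

    module Turning (p : ℕ) (p≤n : p ≤ n) (climbs : ∀ {j} → j < p → Climbs j)
                   (falls-at : p < n → Falls p) where

      falls : ∀ j → p ≤ j → j < n → Falls j
      falls j p≤j j<n with p ≟ j
      ... | yes p≡j = subst Falls p≡j (falls-at (subst (_< n) (sym p≡j) j<n))
      falls zero    p≤0   _     | no p≢0   = ⊥-elim (p≢0 (n≤0⇒n≡0 p≤0))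
      falls (suc j) p≤1+j 1+j<n | no p≢1+j =
        falls-persist (falls j (m<1+n⇒m≤n (≤∧≢⇒< p≤1+j p≢1+j)) (<-trans (n<1+n j) 1+j<n)) 1+j<n

      climb-depth : ∀ j → j ≤ p → j + depth (v j) ≡ depth (v 0)
      climb-depth zero    _     = refl
      climb-depth (suc j) 1+j≤p with climbs 1+j≤p
      ... | _ , vⱼ≡i∷vⱼ₊₁ = begin
        suc j + depth (v (suc j))    ≡⟨ +-suc j _ ⟨
        j + suc (depth (v (suc j)))  ≡⟨ cong (λ w → j + length w) vⱼ≡i∷vⱼ₊₁ ⟨
        j + depth (v j)              ≡⟨ climb-depth j (<⇒≤ 1+j≤p) ⟩
        depth (v 0)                  ∎
        where open ≡-Reasoning

      fall-depth : ∀ j → p ≤ j → j ≤ n → j ≤ p + depth (v j)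
      fall-depth zero    _     _     = z≤n
      fall-depth (suc j) p≤1+j 1+j≤n with p ≟ suc j
      ... | yes p≡1+j = subst (_≤ p + depth (v (suc j))) p≡1+j (m≤m+n p _)
      ... | no p≢1+j with m<1+n⇒m≤n (≤∧≢⇒< p≤1+j p≢1+j)
      ...   | p≤j with falls j p≤j 1+j≤n
      ...     | _ , vⱼ₊₁≡i∷vⱼ = begin
        suc j                  ≤⟨ s≤s (fall-depth j p≤j (<⇒≤ 1+j≤n)) ⟩
        suc (p + depth (v j))  ≡⟨ +-suc p _ ⟨
        p + suc (depth (v j))  ≡⟨ cong (λ w → p + length w) vⱼ₊₁≡i∷vⱼ ⟨
        p + depth (v (suc j))  ∎
        where open ≤-Reasoning

      p≤h : p ≤ h
      p≤h = ≤-trans (m≤m+n p _) (≤-trans (≤-reflexive (climb-depth p ≤-refl)) (proj₂ (v 0)))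

      n≤p+h : n ≤ p + h
      n≤p+h = ≤-trans (fall-depth n p≤n ≤-refl) (+-monoʳ-≤ p (proj₂ (v n)))

      valley : Valley k n p s
      valley = record
        { p≤n      = p≤n
        ; descends = λ j 1+j<p → descends (climbs (<-trans (n<1+n j) 1+j<p)) (climbs 1+j<p)
        ; ascends  = λ j p≤j 1+j<n →
                       ascends (falls j p≤j (<-trans (n<1+n j) 1+j<n)) (falls (suc j) (m≤n⇒m≤1+n p≤j) 1+j<n)
        ; turns    = λ j 1+j≡p p<n → let 1+j<n = subst (_< n) (sym 1+j≡p) p<n in
                       turns (climbs (subst (j <_) 1+j≡p ≤-refl))
                             (falls (suc j) (≤-reflexive (sym 1+j≡p)) 1+j<n) 1+j<n
        }
        where
          descends : ∀ {j} → Climbs j → Climbs (suc j) → Step k (s (suc j)) (s j)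
          descends {j} cⱼ@(i , vⱼ≡i∷vⱼ₊₁) cⱼ₊₁ =
            subst₂ (Step k) (sym (s-climb (suc j) cⱼ₊₁)) (sym (trans (s-climb j cⱼ) (cong weight vⱼ≡i∷vⱼ₊₁)))
                   (Step-+ (vertexWeight (v (suc j))) i)
          ascends : ∀ {j} → Falls j → Falls (suc j) → Step k (s j) (s (suc j))
          ascends {j} fⱼ fⱼ₊₁@(i , vⱼ₊₂≡i∷vⱼ₊₁) =
            subst₂ (Step k) (sym (s-fall j fⱼ)) (sym (trans (s-fall (suc j) fⱼ₊₁) (cong weight vⱼ₊₂≡i∷vⱼ₊₁)))
                   (Step-+ (vertexWeight (v (suc j))) i)
          turns : ∀ {j} → Climbs j → Falls (suc j) → suc j < n → Turn k (s j) (s (suc j))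
          turns {j} cⱼ@(x , vⱼ≡x∷vⱼ₊₁) fⱼ₊₁@(y , vⱼ₊₂≡y∷vⱼ₊₁) 1+j<n =
            subst₂ (Turn k) (sym (trans (s-climb j cⱼ) (cong weight vⱼ≡x∷vⱼ₊₁)))
                            (sym (trans (s-fall (suc j) fⱼ₊₁) (cong weight vⱼ₊₂≡y∷vⱼ₊₁)))
                   (Turn-+ (vertexWeight (v (suc j))) x≢y)
            where
              x≢y : x ≢ y
              x≢y x≡y = distinct (n≤1+n (suc j)) 1+j<n
                (TreeV-≡ (trans vⱼ≡x∷vⱼ₊₁ (trans (cong (_∷ proj₁ (v (suc j))) x≡y) (sym vⱼ₊₂≡y∷vⱼ₊₁))))

    profile : ∃ λ p → Valley k n p s × p ≤ h × n ≤ p + h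
    profile with turn-search n ≤-refl
    ... | p , p≤n , climbs , falls-at = p , valley , p≤h , n≤p+h
      where open Turning p p≤n climbs falls-at

weightColoring-nonrepetitive : ∀ {k h M} .{{_ : NonZero M}} → 1 ≤ k → 3 ≤ h → (h + 1) * k ≤ M + M →
                               Nonrepetitive (weightColoring {k} {h} M)
weightColoring-nonrepetitive 1≤k 3≤h wide []       (() , _)
weightColoring-nonrepetitive 1≤k 3≤h wide (x ∷ xs) _                 ([] , () , _)
weightColoring-nonrepetitive {k} {h} {M} 1≤k 3≤h wide (x ∷ xs) (walk , uniq , _)
                             (zs@(_ ∷ ys) , _ , colors≡zs++zs) =
  let _ , valley , p≤h , n≤p+h = profile in
  valley-not-repetition 1≤k 3≤h wide (length ys) valley p≤h n≤p+h periodic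
  where
    c = weightColoring {k} {h} M
    r = length zs
    len : length (x ∷ xs) ≡ suc (r + r)
    len = begin
      length (x ∷ xs)                        ≡⟨ length-colorsAlong c x xs ⟨
      suc (length (colorsAlong c (x ∷ xs)))  ≡⟨ cong (suc ∘ length) colors≡zs++zs ⟩
      suc (length (zs ++ zs))                ≡⟨ cong suc (length-++ zs) ⟩
      suc (r + r)                            ∎
      where open ≡-Reasoning
    open PathProfile walk uniq (r + r) len
    colours = colorsAlong c (x ∷ xs)
    d = 0 mod M
    colour-nth : ∀ {j} → j < r + r → toℕ (nth d colours j) ≡ s j % M
    colour-nth {j} j<n =
      trans (cong toℕ (colorsAlong-nth _ c (x ∷ xs) (subst (suc j <_) (sym len) (s≤s j<n)))) (toℕ-fromℕ< _)
    periodic : ∀ j → j < r → s j % M ≡ s (j + r) % M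
    periodic j j<r = begin
      s j % M                      ≡⟨ colour-nth (<-≤-trans j<r (m≤m+n r r)) ⟨
      toℕ (nth d colours j)        ≡⟨ cong toℕ (subst (λ cs → nth d cs j ≡ nth d cs (j + r))
                                                      (sym colors≡zs++zs) (nth-++-self d zs j<r)) ⟩
      toℕ (nth d colours (j + r))  ≡⟨ colour-nth (+-monoˡ-< r j<r) ⟩
      s (j + r) % M                ∎
      where open ≡-Reasoning

n≤⌈n/2⌉+⌈n/2⌉ : ∀ n → n ≤ ⌈ n /2⌉ + ⌈ n /2⌉
n≤⌈n/2⌉+⌈n/2⌉ n = subst (_≤ ⌈ n /2⌉ + ⌈ n /2⌉) (⌊n/2⌋+⌈n/2⌉≡n n) (+-monoˡ-≤ ⌈ n /2⌉ (⌊n/2⌋≤⌈n/2⌉ n))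

corollary12 : (k h : ℕ) → 1 ≤ k → 3 ≤ h → πe≤ (T k h) ⌈ (h + 1) * k /2⌉
corollary12 k h 1≤k 3≤h =
  weightColoring M , weightColoring-nonrepetitive 1≤k 3≤h (n≤⌈n/2⌉+⌈n/2⌉ ((h + 1) * k))
  where
    M = ⌈ (h + 1) * k /2⌉
    instance
      M≢0 : NonZero M
      M≢0 = >-nonZero (⌈n/2⌉-mono (*-mono-≤ (m≤n+m 1 h) 1≤k))
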